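{- Let $a_1,\ldots,a_m$ be positive integers satisfying: for every $i=2,\ldots,m$ there exists $j<i$ such that $\operatorname{lcm}(\gcd(a_1,\ldots,a_{i-1}),a_i)=\operatorname{lcm}(a_j,a_i)$. For $i=2,\ldots,m$ put $\ell_i=\operatorname{lcm}(\gcd(a_1,\ldots,a_{i-1}),a_i)$. Then for every positive integer $k$, $$\mathbf{1}[a_i\mid k\text{ for some }i]=\sum_{i=1}^m\mathbf{1}[a_i\mid k]-\sum_{i=2}^m\mathbf{1}[\ell_i\mid k].$$
   Context: $\mathbf{1}[\cdot]$ denotes the indicator function (equal to $1$ if the condition holds and $0$ otherwise); $\mid$ means "divides"; $\gcd$ and $\operatorname{lcm}$ denote greatest common divisor and least common multiple. -}

module Defs where

open import Data.Nat using (ℕ; zero; suc; _+_)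
open import Data.Nat.GCD using (gcd)
open import Data.Nat.LCM using (lcm)
open import Data.Nat.Divisibility using (_∣?_)
open import Data.Bool using (if_then_else_)
open import Relation.Nullary using (does)
open import Data.List using (upTo)
import Data.Bool.ListAction as BL

-- Sequences a₁,…,aₘ are represented 0-indexed as a : ℕ → ℕ, using a 0 … a (m-1).

-- gcdPrefix a i = gcd(a 0, …, a (i-1))  (gcd of the empty list is 0, the gcd identity)
gcdPrefix : (ℕ → ℕ) → ℕ → ℕ
gcdPrefix a zero    = 0
gcdPrefix a (suc i) = gcd (gcdPrefix a i) (a i)

ell : (ℕ → ℕ) → ℕ → ℕ
ell a i = lcm (gcdPrefix a i) (a i)

ind : ℕ → ℕ → ℕ
ind d k = if does (d ∣? k) then 1 else 0

sumTo : ℕ → (ℕ → ℕ) → ℕ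
sumTo zero    f = 0
sumTo (suc n) f = sumTo n f + f n

sumFrom : ℕ → ℕ → (ℕ → ℕ) → ℕ
sumFrom s n f = sumTo n (λ t → f (s + t))

indSome : ℕ → (ℕ → ℕ) → ℕ → ℕ
indSome m a k = if BL.any (λ i → does (a i ∣? k)) (upTo m) then 1 else 0

module Submission where

-- Fix k and write  x i = 1[a i ∣ k],  A n = 1[a i ∣ k for some i < n]
-- and  z i = 1[ℓ i ∣ k]  (all as booleans, read as 0/1 via ι).  Two facts drive
-- the identity:
--   * A (n+1) = A n ∨ x n, and
--   * z n = A n ∧ x n  for 1 ≤ n, which is where the hypothesis is used:
--     ℓ n ∣ k  ⇔  (a i ∣ k for some i < n) ∧ a n ∣ k.   The direction ⇐ holds because
--     gcd(a 0,…,a (n-1)) divides every earlier a i; the direction ⇒ uses the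
--     witness j with ℓ n = lcm(a j, a n), so a j ∣ ℓ n.
-- Since ι(p ∧ q) + ι(p ∨ q) = ι p + ι q, adding z n to A (n+1) turns it into
-- A n + x n, and the sum telescopes:  Σ_{1≤i<m} z i + A m = Σ_{i<m} x i.

open import Defs
open import Data.Bool using (Bool; true; false; T; _∧_; _∨_; if_then_else_)
open import Data.Bool.Properties using (T-≡; T-∧; T-∨; ⇔→≡)
import Data.Bool.ListAction as BL
open import Data.Integer using (+_; _-_; _⊖_)
open import Data.Integer.Properties using (m-n≡m⊖n; ⊖-≥)
open import Data.List using (upTo)
open import Data.List.Membership.Propositional using (lose; find)
open import Data.List.Membership.Propositional.Properties using (∈-upTo⁺; ∈-upTo⁻)
open import Data.List.Relation.Unary.Any.Properties using (any⁺; any⁻)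
open import Data.Nat using (ℕ; zero; suc; _+_; _<_; _≤_; _∸_; s≤s; z≤n)
open import Data.Nat.Divisibility using (_∣_; _∣?_; ∣-trans)
open import Data.Nat.GCD using (gcd[m,n]∣m; gcd[m,n]∣n)
open import Data.Nat.LCM using (lcm; m∣lcm[m,n]; n∣lcm[m,n]; lcm-least)
open import Data.Nat.Properties
  using (+-assoc; m≤m+n; m+n∸m≡n; m<1+n⇒m<n∨m≡n; m<n⇒m<1+n; n<1+n)
open import Data.Product using (_×_; _,_; ∃-syntax)
open import Data.Sum using (inj₁; inj₂)
open import Data.Unit using (tt)
open import Function using (_⇔_; mk⇔; Equivalence; _∘_; const)
import Function.Properties.Equivalence as ⇔
open import Relation.Binary.PropositionalEquality
open import Relation.Nullary using (Dec; does; yes; no)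

open Equivalence using (to; from)

ι : Bool → ℕ
ι b = if b then 1 else 0

ι-∧-∨ : (p q : Bool) → ι (p ∧ q) + ι (p ∨ q) ≡ ι p + ι q
ι-∧-∨ false false = refl
ι-∧-∨ false true  = refl
ι-∧-∨ true  false = refl
ι-∧-∨ true  true  = refl

T-injective : {p q : Bool} → T p ⇔ T q → p ≡ q
T-injective p⇔q = ⇔→≡ (⇔.trans (⇔.sym T-≡) (⇔.trans p⇔q T-≡))

T-does : {P : Set} (P? : Dec P) → T (does P?) ⇔ P
T-does (yes p)  = mk⇔ (const p) (const tt)
T-does (no ¬p) = mk⇔ (λ ()) ¬p

anyUpTo : (ℕ → Bool) → ℕ → Bool
anyUpTo x n = BL.any x (upTo n)

T-anyUpTo : (x : ℕ → Bool) (n : ℕ) → T (anyUpTo x n) ⇔ (∃[ i ] (i < n × T (x i)))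
T-anyUpTo x n = mk⇔ witness (λ (i , i<n , xi) → any⁺ x (lose (∈-upTo⁺ i<n) xi))
  where
  witness : T (anyUpTo x n) → ∃[ i ] (i < n × T (x i))
  witness t with find (any⁻ x (upTo n) t)
  ... | i , i∈upTo , xi = i , ∈-upTo⁻ i∈upTo , xi

anyUpTo-suc : (x : ℕ → Bool) (n : ℕ) → anyUpTo x (suc n) ≡ anyUpTo x n ∨ x n
anyUpTo-suc x n = T-injective (mk⇔ split join)
  where
  split : T (anyUpTo x (suc n)) → T (anyUpTo x n ∨ x n)
  split t with to (T-anyUpTo x (suc n)) t
  ... | i , i<1+n , xi with m<1+n⇒m<n∨m≡n i<1+n
  ...   | inj₁ i<n  = from T-∨ (inj₁ (from (T-anyUpTo x n) (i , i<n , xi)))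
  ...   | inj₂ refl = from T-∨ (inj₂ xi)

  join : T (anyUpTo x n ∨ x n) → T (anyUpTo x (suc n))
  join t with to T-∨ t
  ... | inj₁ old with to (T-anyUpTo x n) old
  ...   | i , i<n , xi = from (T-anyUpTo x (suc n)) (i , m<n⇒m<1+n i<n , xi)
  join t | inj₂ xn = from (T-anyUpTo x (suc n)) (n , n<1+n n , xn)

telescope : (x z : ℕ → Bool) (n : ℕ) →
  (∀ i → i < n → z (suc i) ≡ anyUpTo x (suc i) ∧ x (suc i)) →
  sumTo n (ι ∘ z ∘ suc) + ι (anyUpTo x (suc n)) ≡ sumTo (suc n) (ι ∘ x)
telescope x z zero    _      = cong ι (anyUpTo-suc x 0)
telescope x z (suc n) z-eq = begin
  S + ι (z (suc n)) + ι (anyUpTo x (suc (suc n)))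
    ≡⟨ cong₂ (λ p q → S + ι p + ι q) (z-eq n (n<1+n n)) (anyUpTo-suc x (suc n)) ⟩
  S + ι (A ∧ x (suc n)) + ι (A ∨ x (suc n))
    ≡⟨ +-assoc S _ _ ⟩
  S + (ι (A ∧ x (suc n)) + ι (A ∨ x (suc n)))
    ≡⟨ cong (λ s → S + s) (ι-∧-∨ A (x (suc n))) ⟩
  S + (ι A + ι (x (suc n)))
    ≡⟨ +-assoc S (ι A) _ ⟨
  S + ι A + ι (x (suc n))
    ≡⟨ cong (_+ ι (x (suc n))) (telescope x z n (λ i i<n → z-eq i (m<n⇒m<1+n i<n))) ⟩
  sumTo (suc (suc n)) (ι ∘ x) ∎
  where
  open ≡-Reasoning
  S = sumTo n (ι ∘ z ∘ suc)
  A = anyUpTo x (suc n)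

gcdPrefix-∣ : (a : ℕ → ℕ) {i n : ℕ} → i < n → gcdPrefix a n ∣ a i
gcdPrefix-∣ a {i} {suc n} i<1+n with m<1+n⇒m<n∨m≡n i<1+n
... | inj₁ i<n  = ∣-trans (gcd[m,n]∣m (gcdPrefix a n) (a n)) (gcdPrefix-∣ a i<n)
... | inj₂ refl = gcd[m,n]∣n (gcdPrefix a n) (a n)

ell-∣⇔ : (a : ℕ → ℕ) (k n : ℕ) →
  ∃[ j ] (j < n × ell a n ≡ lcm (a j) (a n)) →
  ell a n ∣ k ⇔ ((∃[ i ] (i < n × a i ∣ k)) × a n ∣ k)
ell-∣⇔ a k n (j , j<n , ℓ≡lcm) = mk⇔ divides-both divides-ell
  where
  divides-both : ell a n ∣ k → (∃[ i ] (i < n × a i ∣ k)) × a n ∣ k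
  divides-both ℓ∣k =
    (j , j<n , ∣-trans (subst (a j ∣_) (sym ℓ≡lcm) (m∣lcm[m,n] (a j) (a n))) ℓ∣k)
    , ∣-trans (n∣lcm[m,n] (gcdPrefix a n) (a n)) ℓ∣k

  divides-ell : (∃[ i ] (i < n × a i ∣ k)) × a n ∣ k → ell a n ∣ k
  divides-ell ((i , i<n , ai∣k) , an∣k) =
    lcm-least (∣-trans (gcdPrefix-∣ a i<n) ai∣k) an∣k

ell-indicator : (a : ℕ → ℕ) (k n : ℕ) →
  ∃[ j ] (j < n × ell a n ≡ lcm (a j) (a n)) →
  does (ell a n ∣? k) ≡ anyUpTo (λ i → does (a i ∣? k)) n ∧ does (a n ∣? k)
ell-indicator a k n witness = T-injective (mk⇔ to-∧ from-∧)
  where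
  x : ℕ → Bool
  x i = does (a i ∣? k)

  to-∧ : T (does (ell a n ∣? k)) → T (anyUpTo x n ∧ x n)
  to-∧ t with to (ell-∣⇔ a k n witness) (to (T-does (ell a n ∣? k)) t)
  ... | (i , i<n , ai∣k) , an∣k =
    from T-∧ ( from (T-anyUpTo x n) (i , i<n , from (T-does (a i ∣? k)) ai∣k)
             , from (T-does (a n ∣? k)) an∣k )

  from-∧ : T (anyUpTo x n ∧ x n) → T (does (ell a n ∣? k))
  from-∧ t with to T-∧ t
  ... | some , xn with to (T-anyUpTo x n) some
  ...   | i , i<n , xi = from (T-does (ell a n ∣? k)) (from (ell-∣⇔ a k n witness)
          ((i , i<n , to (T-does (a i ∣? k)) xi) , to (T-does (a n ∣? k)) xn))

+-∸-ℤ : (s t : ℕ) → + (s + t) - + s ≡ + t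
+-∸-ℤ s t = begin
  + (s + t) - + s  ≡⟨ m-n≡m⊖n (s + t) s ⟩
  (s + t) ⊖ s      ≡⟨ ⊖-≥ (m≤m+n s t) ⟩
  + (s + t ∸ s)    ≡⟨ cong +_ (m+n∸m≡n s t) ⟩
  + t              ∎
  where open ≡-Reasoning

-- The theorem: telescope with x i = 1[a i ∣ k] and z i = 1[ℓ i ∣ k], then move the
-- ℓ-sum to the other side in ℤ.
lemma4 : (m : ℕ) (a : ℕ → ℕ) →
    (∀ i → i < m → 0 < a i) →
    (∀ i → 1 ≤ i → i < m → ∃[ j ] (j < i × ell a i ≡ lcm (a j) (a i))) →
    (k : ℕ) → 0 < k →
    + indSome m a k
      ≡ + sumTo m (λ i → ind (a i) k) - + sumFrom 1 (m ∸ 1) (λ i → ind (ell a i) k)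
lemma4 zero    a _ _       k _ = refl
lemma4 (suc n) a _ witness k _ = sym (begin
  + sumTo (suc n) (ι ∘ x) - + L  ≡⟨ cong (λ s → + s - + L) (telescope x z n z-eq) ⟨
  + (L + indSome (suc n) a k) - + L ≡⟨ +-∸-ℤ L (indSome (suc n) a k) ⟩
  + indSome (suc n) a k            ∎)
  where
  open ≡-Reasoning
  x z : ℕ → Bool
  x i = does (a i ∣? k)
  z i = does (ell a i ∣? k)
  L = sumFrom 1 n (λ i → ind (ell a i) k)
  z-eq : ∀ i → i < n → z (suc i) ≡ anyUpTo x (suc i) ∧ x (suc i)
  z-eq i i<n = ell-indicator a k (suc i) (witness (suc i) (s≤s z≤n) (s≤s i<n))
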